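{- For finite digraphs $G,H,H'$ and $\xi\in\mathcal{H}(G,H)$, let $\Theta_{G,H'}(\xi)=\{\zeta\in\mathcal{H}(G,H'): \mathcal{G}(\zeta)=\mathcal{G}(\xi)\}$. Then for finite digraphs $R,S$ and a class $\mathfrak{D}'$ of finite digraphs, $R\sqsubseteq_\Gamma S$ with respect to $\mathfrak{D}'$ holds if and only if $\#\Theta_{G,R}(\xi)\le\#\Theta_{G,S}(\xi)$ for all $G\in\mathfrak{D}'$ and all $\xi\in\mathcal{H}(G,R)$.
   Context: Digraphs $G=(V(G),A(G))$: finite non-empty $V(G)$, $A(G)\subseteq V(G)\times V(G)$. $\mathcal{H}(G,H)$: homomorphisms (maps with $\xi(v)\xi(w)\in A(H)$ for $vw\in A(G)$). $v,w$ adjacent if $vw$ or $wv$ is an arc. For $X\subseteq V(G)$, $v\in X$, $\gamma_X(v)$ = set of $w\in X$ equal to $v$ or joined to $v$ by a sequence in $X$ of consecutively adjacent vertices; $\Gamma_\xi(v)=\gamma_{\xi^{ -1}(\xi(v))}(v)$. For $\xi\in\mathcal{H}(G,H)$, $\mathcal{G}(\xi)$ is the digraph with vertex set $\{\Gamma_\xi(v): v\in V(G)\}$ and arcs $(\mathfrak{a},\mathfrak{b})$ whenever some $a\in\mathfrak{a}$, $b\in\mathfrak{b}$ satisfy $ab\in A(G)$. $R\sqsubseteq_\Gamma S$ w.r.t. $\mathfrak{D}'$ means: for a representative system $\mathfrak{D}'_r$ of $\mathfrak{D}'$ up to isomorphism there exist injective maps $\rho_G:\mathcal{H}(G,R)\to\mathcal{H}(G,S)$,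 $G\in\mathfrak{D}'_r$, with $\Gamma_{\rho_G(\xi)}(v)=\Gamma_\xi(v)$ for all $G\in\mathfrak{D}'_r$, $\xi\in\mathcal{H}(G,R)$, $v\in V(G)$. -}

module Defs where

open import Level using (Level)
open import Data.Nat using (ℕ; _≤_)
open import Data.Fin using (Fin)
open import Data.Bool using (Bool; true)
open import Data.Vec using (Vec; lookup)
open import Data.List using (List; length)
open import Data.List.Relation.Unary.All using (All)
open import Data.List.Relation.Unary.Unique.Propositional using (Unique)
open import Data.List.Membership.Propositional using (_∈_)
open import Data.Product using (Σ; ∃; ∃₂; _×_)
open import Data.Sum using (_⊎_)
open import Function.Bundles using (_⇔_; _↔_; Inverse)
open import Relation.Binary.PropositionalEquality using (_≡_)

record Digraph : Set where
  field
    order    : ℕ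
    nonempty : 1 ≤ order
    arc      : Fin order → Fin order → Bool
open Digraph public

V : Digraph → Set
V G = Fin (order G)

-- maps V(G) → V(H) are represented as vectors (so ≡ is extensional equality of maps)
Map : Digraph → Digraph → Set
Map G H = Vec (V H) (order G)

IsHom : (G H : Digraph) → Map G H → Set
IsHom G H f = ∀ v w → arc G v w ≡ true → arc H (lookup f v) (lookup f w) ≡ true

record Hom (G H : Digraph) : Set where
  field
    map : Map G H
    hom : IsHom G H map
open Hom public

Adj : (G : Digraph) → V G → V G → Set
Adj G v w = (arc G v w ≡ true) ⊎ (arc G w v ≡ true)

-- Conn G f v w : w equals v, or is joined to v by a sequence of consecutively
-- adjacent vertices inside the fibre X = f⁻¹(f(v)).  Γ_f(v) = γ_X(v).
data Conn {m : ℕ} (G : Digraph) (f : Vec (Fin m) (order G)) (v : V G) : V G → Set where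
  here : Conn G f v v
  step : ∀ {u w} → Conn G f v u → Adj G u w → lookup f w ≡ lookup f v → Conn G f v w

Γ : {m : ℕ} (G : Digraph) → Vec (Fin m) (order G) → V G → V G → Set
Γ G f v w = Conn G f v w

-- The digraph 𝓖(f): vertices are the sets Γ_f(v) (subsets of V(G) as predicates,
-- compared extensionally), arcs (𝔞,𝔟) when some a ∈ 𝔞, b ∈ 𝔟 have ab ∈ A(G).
Subset : Digraph → Set₁
Subset G = V G → Set

IsVertex𝓖 : {m : ℕ} (G : Digraph) → Vec (Fin m) (order G) → Subset G → Set
IsVertex𝓖 G f 𝔞 = ∃ λ v → ∀ w → 𝔞 w ⇔ Γ G f v w

IsArc𝓖 : {m : ℕ} (G : Digraph) → Vec (Fin m) (order G) → Subset G → Subset G → Set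
IsArc𝓖 G f 𝔞 𝔟 =
  IsVertex𝓖 G f 𝔞 × IsVertex𝓖 G f 𝔟 × ∃₂ λ a b → 𝔞 a × 𝔟 b × arc G a b ≡ true

Same𝓖 : {m m' : ℕ} (G : Digraph) → Vec (Fin m) (order G) → Vec (Fin m') (order G) → Set₁
Same𝓖 G f g =
  (∀ 𝔞 → IsVertex𝓖 G f 𝔞 ⇔ IsVertex𝓖 G g 𝔞) ×
  (∀ 𝔞 𝔟 → IsArc𝓖 G f 𝔞 𝔟 ⇔ IsArc𝓖 G g 𝔞 𝔟)

Θ : {m : ℕ} (G H' : Digraph) → Vec (Fin m) (order G) → Map G H' → Set₁
Θ G H' ξ ζ = IsHom G H' ζ × Same𝓖 G ζ ξ

Card : {ℓ : Level} {A : Set} → (A → Set ℓ) → ℕ → Set ℓ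
Card {A = A} P k =
  Σ (List A) λ xs → Unique xs × All P xs × (∀ x → P x → x ∈ xs) × length xs ≡ k

_≤#_ : {ℓ : Level} {A B : Set} → (A → Set ℓ) → (B → Set ℓ) → Set ℓ
P ≤# Q = ∀ k l → Card P k → Card Q l → k ≤ l

Iso : Digraph → Digraph → Set
Iso G H = Σ (V G ↔ V H) λ φ → ∀ v w → arc H (Inverse.to φ v) (Inverse.to φ w) ≡ arc G v w

IsRepSystem : (Digraph → Set) → (Digraph → Set) → Set
IsRepSystem 𝔇 𝔇r =
  (∀ G → 𝔇r G → 𝔇 G) ×
  (∀ G → 𝔇 G → ∃ λ H → 𝔇r H × Iso G H) ×
  (∀ H H' → 𝔇r H → 𝔇r H' → Iso H H' → H ≡ H')

-- R ⊑_Γ S w.r.t. 𝔇', given the representative system 𝔇r of 𝔇'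
_⊑Γ_wrt_ : Digraph → Digraph → (Digraph → Set) → Set
R ⊑Γ S wrt 𝔇r = ∀ G → 𝔇r G →
  Σ (Hom G R → Hom G S) λ ρ →
    (∀ ξ ξ' → map (ρ ξ) ≡ map (ρ ξ') → map ξ ≡ map ξ') ×
    (∀ ξ v w → Γ G (map (ρ ξ)) v w ⇔ Γ G (map ξ) v w)

{-# OPTIONS --safe #-}
-- 𝓖(ζ) = 𝓖(ξ) holds exactly when ζ and ξ induce the same sets Γ, so a Γ-preserving
-- injection ρ_G : 𝓗(G,R) → 𝓗(G,S) maps each Θ_{G,R}(ξ) injectively into Θ_{G,S}(ξ); a G that
-- is only isomorphic to a representative inherits such an injection along the isomorphism.
-- Conversely the sets Θ_{G,R}(ξ) are the classes of 𝓗(G,R) under "same sets Γ", and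
-- injections of each class into the corresponding Θ_{G,S}(ξ), which exist by counting,
-- glue to a Γ-preserving injection. Γ is decidable (reachability in a finite graph), so
-- all these sets can be enumerated.
module Submission where

open import Defs hiding (Subset)
open import Level using (Level)
open import Data.Bool using (true)
open import Data.Bool.Properties using (T-≡) renaming (_≟_ to _≟ᵇ_)
open import Data.Nat using (ℕ; zero; suc; _≤_; z≤n)
open import Data.Nat.Properties using (≤-<-trans; <⇒≱)
open import Data.Fin using (Fin; zero; suc; inject≤) renaming (_≟_ to _≟ᶠ_)
open import Data.Fin.Properties using (any?; all?; injective⇒≤; inject≤-injective)
open import Data.Fin.Subset using (Subset; _⊆_; _⊈_; _⊂_; _∪_; ⁅_⁆; ∣_∣)
  renaming (_∈_ to _∈ₛ_)
open import Data.Fin.Subset.Properties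
  using (_∈?_; _⊆?_; x∈⁅x⁆; x∈⁅y⁆⇒x≡y; p⊆p∪q; q⊆p∪q; x∈p∪q⁻; p⊂q⇒∣p∣<∣q∣; ∣p∣≤n)
open import Data.Vec using (Vec; []; _∷_; lookup; tabulate)
open import Data.Vec.Properties using (lookup∘tabulate; []=⇒lookup; lookup⇒[]=)
import Data.Vec.Properties as Vec
open import Data.List using (List; []; _∷_; length; filter; concatMap; allFin; deduplicate; [_])
import Data.List as List
open import Data.List.Properties using (filter-≐)
open import Data.List.Membership.Propositional using (_∈_)
open import Data.List.Membership.Propositional.Properties
  using (∈-lookup; ∈-map⁺; ∈-concatMap⁺; ∈-allFin; ∈-deduplicate⁺; ∈-filter⁺; ∈-filter⁻)
open import Data.List.Membership.Setoid.Properties using (index-injective)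
open import Data.List.Relation.Unary.Any using (here; index)
import Data.List.Relation.Unary.Any as Any
import Data.List.Relation.Unary.All as All
open import Data.List.Relation.Unary.All.Properties using (all-filter)
open import Data.List.Relation.Unary.AllPairs using (_∷_)
open import Data.List.Relation.Unary.Unique.Propositional using (Unique)
open import Data.List.Relation.Unary.Unique.Propositional.Properties using (filter⁺)
open import Data.List.Relation.Unary.Unique.DecPropositional.Properties using (deduplicate-!)
open import Data.Product using (Σ; _×_; _,_; proj₁; proj₂)
open import Data.Sum using (_⊎_; inj₁; inj₂)
open import Function using (_∘_)
open import Function.Bundles using (_⇔_; mk⇔; Equivalence; Inverse)
open import Function.Construct.Composition using (_⇔-∘_)
open import Function.Construct.Identity using (⇔-id)
open import Function.Construct.Symmetry using (⇔-sym)
open import Function.Properties.Inverse using (↔-sym)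
open import Relation.Binary using (Rel)
open import Relation.Binary.Definitions using () renaming (Decidable to Decidable₂)
open import Relation.Binary.Construct.Closure.ReflexiveTransitive using (Star; ε; _◅_; _◅◅_)
open import Relation.Binary.PropositionalEquality
  using (_≡_; refl; sym; trans; cong; cong₂; subst; subst₂; setoid)
open import Relation.Nullary using (Dec; yes; no; ¬?; contradiction)
open import Relation.Nullary.Decidable using (map′; _×-dec_; _⊎-dec_; _→-dec_; isYes; toWitness; fromWitness; decidable-stable)
open import Relation.Unary using (Pred; Decidable)

private
  variable
    ℓ : Level
    A B : Set
    m n : ℕ

Adj-sym : ∀ {G u w} → Adj G u w → Adj G w u
Adj-sym (inj₁ uw) = inj₂ uw
Adj-sym (inj₂ wu) = inj₁ wu

module _ {G : Digraph} {f : Vec (Fin m) (order G)} where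

  Conn-fibre : ∀ {v w} → Conn G f v w → lookup f w ≡ lookup f v
  Conn-fibre here         = refl
  Conn-fibre (step _ _ e) = e

  Conn-trans : ∀ {u v w} → Conn G f u v → Conn G f v w → Conn G f u w
  Conn-trans c here         = c
  Conn-trans c (step d a e) = step (Conn-trans c d) a (trans e (Conn-fibre c))

  Conn-sym : ∀ {v w} → Conn G f v w → Conn G f w v
  Conn-sym here = here
  Conn-sym (step c a e) =
    Conn-trans (step here (Adj-sym {G} a) (trans (Conn-fibre c) (sym e))) (Conn-sym c)

SameΓ : {m m' : ℕ} (G : Digraph) → Vec (Fin m) (order G) → Vec (Fin m') (order G) → Set
SameΓ G f g = ∀ v w → Γ G f v w ⇔ Γ G g v w

module _ {G : Digraph} where

  SameΓ-refl : {f : Vec (Fin m) (order G)} → SameΓ G f f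
  SameΓ-refl _ _ = ⇔-id _

  SameΓ-sym : ∀ {m'} {f : Vec (Fin m) (order G)} {g : Vec (Fin m') (order G)} →
    SameΓ G f g → SameΓ G g f
  SameΓ-sym f~g v w = ⇔-sym (f~g v w)

  SameΓ-trans : ∀ {m' m''} {f : Vec (Fin m) (order G)} {g : Vec (Fin m') (order G)}
    {h : Vec (Fin m'') (order G)} → SameΓ G f g → SameΓ G g h → SameΓ G f h
  SameΓ-trans f~g g~h v w = g~h v w ⇔-∘ f~g v w

  IsVertex𝓖-resp : ∀ {m'} {f : Vec (Fin m) (order G)} {g : Vec (Fin m') (order G)} →
    SameΓ G f g → ∀ 𝔞 → IsVertex𝓖 G f 𝔞 → IsVertex𝓖 G g 𝔞
  IsVertex𝓖-resp f~g 𝔞 (v , 𝔞≡Γv) = v , λ w → f~g v w ⇔-∘ 𝔞≡Γv w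

  IsArc𝓖-resp : ∀ {m'} {f : Vec (Fin m) (order G)} {g : Vec (Fin m') (order G)} →
    SameΓ G f g → ∀ 𝔞 𝔟 → IsArc𝓖 G f 𝔞 𝔟 → IsArc𝓖 G g 𝔞 𝔟
  IsArc𝓖-resp f~g 𝔞 𝔟 (𝔞-vertex , 𝔟-vertex , ab) =
    IsVertex𝓖-resp f~g 𝔞 𝔞-vertex , IsVertex𝓖-resp f~g 𝔟 𝔟-vertex , ab

  SameΓ⇒Same𝓖 : ∀ {m'} {f : Vec (Fin m) (order G)} {g : Vec (Fin m') (order G)} →
    SameΓ G f g → Same𝓖 G f g
  SameΓ⇒Same𝓖 f~g =
    (λ 𝔞 → mk⇔ (IsVertex𝓖-resp f~g 𝔞) (IsVertex𝓖-resp (SameΓ-sym f~g) 𝔞)) ,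
    (λ 𝔞 𝔟 → mk⇔ (IsArc𝓖-resp f~g 𝔞 𝔟) (IsArc𝓖-resp (SameΓ-sym f~g) 𝔞 𝔟))

  -- Γ_f(v) is a vertex of 𝓖(f), hence of 𝓖(g): it is some Γ_g(u), and u ~ v since v ∈ Γ_f(v).
  Same𝓖⇒SameΓ : ∀ {m'} {f : Vec (Fin m) (order G)} {g : Vec (Fin m') (order G)} →
    Same𝓖 G f g → SameΓ G f g
  Same𝓖⇒SameΓ {f = f} (same-vertices , _) v w
    with Equivalence.to (same-vertices (Γ G f v)) (v , λ _ → ⇔-id _)
  ... | u , Γv≡Γu = mk⇔ (λ c → Conn-trans (Conn-sym u~v) (Equivalence.to (Γv≡Γu w) c))
                        (λ c → Equivalence.from (Γv≡Γu w) (Conn-trans u~v c))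
    where
    u~v = Equivalence.to (Γv≡Γu v) here

-- Decidability

subsetOf : {P : Pred (Fin n) ℓ} → Decidable P → Subset n
subsetOf P? = tabulate (isYes ∘ P?)

∈-subsetOf : {P : Pred (Fin n) ℓ} (P? : Decidable P) {w : Fin n} → w ∈ₛ subsetOf P? ⇔ P w
∈-subsetOf P? {w} = mk⇔
  (λ w∈ → toWitness {a? = P? w} (Equivalence.from T-≡ (trans (sym lookup-w) ([]=⇒lookup w∈))))
  (λ Pw → lookup⇒[]= w (subsetOf P?) (trans lookup-w (Equivalence.to T-≡ (fromWitness Pw))))
  where
  lookup-w = lookup∘tabulate (isYes ∘ P?) w

⊆∧⊉⇒⊂ : {p q : Subset n} → p ⊆ q → q ⊈ p → p ⊂ q
⊆∧⊉⇒⊂ {p = p} {q} p⊆q q⊈p with any? (λ x → (x ∈? q) ×-dec ¬? (x ∈? p))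
... | yes (x , x∈q , x∉p) = p⊆q , x , x∈q , x∉p
... | no ∄x = contradiction
  (λ {x} x∈q → decidable-stable (x ∈? p) (λ x∉p → ∄x (x , x∈q , x∉p))) q⊈p

-- Breadth-first search: reach k is the set of vertices at distance ≤ k from v.
module Reachability {E : Rel (Fin n) ℓ} (E? : Decidable₂ E) (v : Fin n) where

  successors : Subset n → Subset n
  successors S = subsetOf λ w → any? λ u → (u ∈? S) ×-dec E? u w

  reach : ℕ → Subset n
  reach zero    = ⁅ v ⁆
  reach (suc k) = reach k ∪ successors (reach k)

  successors-mono : ∀ {S T} → S ⊆ T → successors S ⊆ successors T
  successors-mono S⊆T w∈ with Equivalence.to (∈-subsetOf _) w∈
  ... | u , u∈S , e = Equivalence.from (∈-subsetOf _) (u , S⊆T u∈S , e)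

  reach-sound : ∀ k {w} → w ∈ₛ reach k → Star E v w
  reach-sound zero    w∈ = subst (Star E v) (sym (x∈⁅y⁆⇒x≡y v w∈)) ε
  reach-sound (suc k) w∈ with x∈p∪q⁻ (reach k) _ w∈
  ... | inj₁ w∈reach = reach-sound k w∈reach
  ... | inj₂ w∈succ with Equivalence.to (∈-subsetOf _) w∈succ
  ...   | u , u∈reach , e = reach-sound k u∈reach ◅◅ (e ◅ ε)

  v∈reach : ∀ k → v ∈ₛ reach k
  v∈reach zero    = x∈⁅x⁆ v
  v∈reach (suc k) = p⊆p∪q _ (v∈reach k)

  Stable : ℕ → Set
  Stable k = reach (suc k) ⊆ reach k

  Stable-suc : ∀ k → Stable k → Stable (suc k)
  Stable-suc k stable w∈ with x∈p∪q⁻ (reach (suc k)) _ w∈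
  ... | inj₁ w∈reach = w∈reach
  ... | inj₂ w∈succ  = q⊆p∪q (reach k) _ (successors-mono stable w∈succ)

  -- Until the search stabilises, each round adds a vertex.
  Stable⊎grows : ∀ k → Stable k ⊎ k ≤ ∣ reach k ∣
  Stable⊎grows zero = inj₂ z≤n
  Stable⊎grows (suc k) with Stable⊎grows k | reach (suc (suc k)) ⊆? reach (suc k)
  ... | inj₁ stable | _          = inj₁ (Stable-suc k stable)
  ... | inj₂ _      | yes stable = inj₁ stable
  ... | inj₂ k≤∣r∣  | no unstable = inj₂ (≤-<-trans k≤∣r∣ (p⊂q⇒∣p∣<∣q∣
    (⊆∧⊉⇒⊂ (p⊆p∪q _) (λ stable → unstable (Stable-suc k stable)))))

  saturated : Stable (suc n)
  saturated with Stable⊎grows (suc n)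
  ... | inj₁ stable     = stable
  ... | inj₂ n<∣reach∣ = contradiction (∣p∣≤n (reach (suc n))) (<⇒≱ n<∣reach∣)

  reach-complete : ∀ {u w} → Star E u w → u ∈ₛ reach (suc n) → w ∈ₛ reach (suc n)
  reach-complete ε u∈ = u∈
  reach-complete (e ◅ s) u∈ = reach-complete s
    (saturated (q⊆p∪q _ _ (Equivalence.from (∈-subsetOf _) (_ , u∈ , e))))

  Star? : ∀ w → Dec (Star E v w)
  Star? w = map′ (reach-sound (suc n)) (λ s → reach-complete s (v∈reach (suc n))) (w ∈? reach (suc n))

Adj? : (G : Digraph) → Decidable₂ (Adj G)
Adj? G u w = (arc G u w ≟ᵇ true) ⊎-dec (arc G w u ≟ᵇ true)

module _ (G : Digraph) (f : Vec (Fin m) (order G)) (v : V G) where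

  FibreStep : Rel (V G) _
  FibreStep u w = Adj G u w × lookup f w ≡ lookup f v

  FibreStep? : Decidable₂ FibreStep
  FibreStep? u w = Adj? G u w ×-dec (lookup f w ≟ᶠ lookup f v)

  Conn⇒Star : ∀ {w} → Conn G f v w → Star FibreStep v w
  Conn⇒Star here         = ε
  Conn⇒Star (step c a e) = Conn⇒Star c ◅◅ ((a , e) ◅ ε)

  Star⇒Conn : ∀ {u w} → Conn G f v u → Star FibreStep u w → Conn G f v w
  Star⇒Conn c ε             = c
  Star⇒Conn c ((a , e) ◅ s) = Star⇒Conn (step c a e) s

  Conn? : ∀ w → Dec (Conn G f v w)
  Conn? w = map′ (Star⇒Conn here) Conn⇒Star (Reachability.Star? FibreStep? v w)

_⇔-dec_ : ∀ {a b} {P : Set a} {Q : Set b} → Dec P → Dec Q → Dec (P ⇔ Q)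
P? ⇔-dec Q? = map′ (λ (to , from) → mk⇔ to from) (λ P⇔Q → Equivalence.to P⇔Q , Equivalence.from P⇔Q)
  ((P? →-dec Q?) ×-dec (Q? →-dec P?))

IsHom? : (G H : Digraph) → Decidable (IsHom G H)
IsHom? G H f = all? λ v → all? λ w →
  (arc G v w ≟ᵇ true) →-dec (arc H (lookup f v) (lookup f w) ≟ᵇ true)

SameΓ? : ∀ {m'} (G : Digraph) (f : Vec (Fin m) (order G)) (g : Vec (Fin m') (order G)) →
  Dec (SameΓ G f g)
SameΓ? G f g = all? λ v → all? λ w → Conn? G f v w ⇔-dec Conn? G g v w

Θ? : (G X : Digraph) (ξ : Vec (Fin m) (order G)) → Decidable (Θ G X ξ)
Θ? G X ξ ζ = map′ (λ (ζ-hom , ζ~ξ) → ζ-hom , SameΓ⇒Same𝓖 ζ~ξ)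
                  (λ (ζ-hom , ζ~ξ) → ζ-hom , Same𝓖⇒SameΓ ζ~ξ)
                  (IsHom? G X ζ ×-dec SameΓ? G ζ ξ)

Θ-resp : ∀ {m'} (G X : Digraph) {ξ : Vec (Fin m) (order G)} {ξ' : Vec (Fin m') (order G)} →
  SameΓ G ξ ξ' → ∀ {ζ} → Θ G X ξ ζ → Θ G X ξ' ζ
Θ-resp G X ξ~ξ' (ζ-hom , ζ~ξ) = ζ-hom , SameΓ⇒Same𝓖 (SameΓ-trans (Same𝓖⇒SameΓ ζ~ξ) ξ~ξ')

-- Finite enumerations and counting

vectors : (m n : ℕ) → List (Vec (Fin m) n)
vectors m zero    = [ [] ]
vectors m (suc n) = concatMap (λ x → List.map (x ∷_) (vectors m n)) (allFin m)

∈-vectors : (xs : Vec (Fin m) n) → xs ∈ vectors m n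
∈-vectors []       = here refl
∈-vectors {m} {suc n} (x ∷ xs) = ∈-concatMap⁺ (λ y → List.map (y ∷_) (vectors m n))
  (Any.map (λ { refl → ∈-map⁺ (x ∷_) (∈-vectors xs) }) (∈-allFin x))

allMaps : (m n : ℕ) → List (Vec (Fin m) n)
allMaps m n = deduplicate (Vec.≡-dec _≟ᶠ_) (vectors m n)

∈-allMaps : (xs : Vec (Fin m) n) → xs ∈ allMaps m n
∈-allMaps xs = ∈-deduplicate⁺ (Vec.≡-dec _≟ᶠ_) (∈-vectors xs)

allMaps-unique : ∀ m n → Unique (allMaps m n)
allMaps-unique m n = deduplicate-! (Vec.≡-dec _≟ᶠ_) (vectors m n)

Card-filter : {P : Pred A ℓ} (P? : Decidable P) {xs : List A} → Unique xs → (∀ x → x ∈ xs) →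
  Card P (length (filter P? xs))
Card-filter P? {xs} xs! ∈xs =
  filter P? xs , filter⁺ P? xs! , all-filter P? xs , (λ x Px → ∈-filter⁺ P? (∈xs x) Px) , refl

lookup-injective : {xs : List A} → Unique xs → ∀ {i j} → List.lookup xs i ≡ List.lookup xs j → i ≡ j
lookup-injective {xs = _ ∷ _} (_ ∷ _)     {zero}  {zero}  _ = refl
lookup-injective {xs = _ ∷ _} (x∉ ∷ _)    {zero}  {suc j} e = contradiction e (All.lookup x∉ (∈-lookup j))
lookup-injective {xs = _ ∷ _} (x∉ ∷ _)    {suc i} {zero}  e = contradiction (sym e) (All.lookup x∉ (∈-lookup i))
lookup-injective {xs = _ ∷ _} (_ ∷ xs!)   {suc i} {suc j} e = cong suc (lookup-injective xs! e)

injection⇒≤# : {P : Pred A ℓ} {Q : Pred B ℓ} (F : ∀ x → P x → B) → (∀ x Px → Q (F x Px)) →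
  (∀ x Px y Py → F x Px ≡ F y Py → x ≡ y) → P ≤# Q
injection⇒≤# {B = B} F F-Q F-injective _ _ (xs , xs! , Pxs , _ , refl) (ys , _ , _ , ∈ys , refl) =
  injective⇒≤ position-injective
  where
  F-at : Fin (length xs) → B
  F-at i = F (List.lookup xs i) (All.lookup Pxs (∈-lookup i))
  position : Fin (length xs) → Fin (length ys)
  position i = index (∈ys (F-at i) (F-Q _ _))
  position-injective : ∀ {i j} → position i ≡ position j → i ≡ j
  position-injective e = lookup-injective xs! (F-injective _ _ _ _ (index-injective (setoid B) _ _ e))

embed : (xs : List A) (ys : List B) → length xs ≤ length ys → {x : A} → x ∈ xs → B
embed xs ys xs≤ys x∈ = List.lookup ys (inject≤ (index x∈) xs≤ys)

embed-∈ : (xs : List A) (ys : List B) (xs≤ys : length xs ≤ length ys) {x : A} (x∈ : x ∈ xs) →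
  embed xs ys xs≤ys x∈ ∈ ys
embed-∈ xs ys xs≤ys x∈ = ∈-lookup _

embed-injective : {xs xs' : List A} {ys ys' : List B} → xs ≡ xs' → ys ≡ ys' → Unique ys →
  ∀ xs≤ys xs'≤ys' {x x'} (x∈ : x ∈ xs) (x'∈ : x' ∈ xs') →
  embed xs ys xs≤ys x∈ ≡ embed xs' ys' xs'≤ys' x'∈ → x ≡ x'
embed-injective {A = A} refl refl ys! xs≤ys xs≤ys' x∈ x'∈ e =
  index-injective (setoid A) x∈ x'∈ (inject≤-injective xs≤ys xs≤ys' _ _ (lookup-injective ys! e))

-- Transport along isomorphisms

pull : {n' : ℕ} → (Fin n → Fin n') → Vec A n' → Vec A n
pull h ζ = tabulate (lookup ζ ∘ h)

module _ {n' : ℕ} (h : Fin n → Fin n') where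

  lookup-pull : (ζ : Vec A n') (v : Fin n) → lookup (pull h ζ) v ≡ lookup ζ (h v)
  lookup-pull ζ = lookup∘tabulate (lookup ζ ∘ h)

  pull-inverse : (k : Fin n' → Fin n) → (∀ v → k (h v) ≡ v) → (g : Vec A n) → pull h (pull k g) ≡ g
  pull-inverse k k∘h g = trans
    (Vec.tabulate-cong λ v → trans (lookup∘tabulate (lookup g ∘ k) (h v)) (cong (lookup g) (k∘h v)))
    (Vec.tabulate∘lookup g)

module _ (G H : Digraph) (h : V G → V H) where

  pull-isHom : (∀ v w → arc G v w ≡ true → arc H (h v) (h w) ≡ true) →
    ∀ X (ζ : Map H X) → IsHom H X ζ → IsHom G X (pull h ζ)
  pull-isHom h-hom X ζ ζ-hom v w vw = subst₂ (λ x y → arc X x y ≡ true)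
    (sym (lookup-pull h ζ v)) (sym (lookup-pull h ζ w)) (ζ-hom (h v) (h w) (h-hom v w vw))

  Conn-map : (∀ {a b} → Adj G a b → Adj H (h a) (h b)) →
    {f : Vec (Fin m) (order G)} {g : Vec (Fin m) (order H)} → (∀ a → lookup g (h a) ≡ lookup f a) →
    ∀ {v w} → Conn G f v w → Conn H g (h v) (h w)
  Conn-map h-adj g∘h≡f here = here
  Conn-map h-adj g∘h≡f {v} (step {w = w} c a e) =
    step (Conn-map h-adj g∘h≡f c) (h-adj a) (trans (g∘h≡f w) (trans e (sym (g∘h≡f v))))

Iso-sym : (G H : Digraph) → Iso G H → Iso H G
Iso-sym G H (φ , φ-arc) = ↔-sym φ , λ a b →
  trans (sym (φ-arc (from a) (from b))) (cong₂ (arc H) (strictlyInverseˡ a) (strictlyInverseˡ b))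
  where open Inverse φ

Iso-adj : (G H : Digraph) (iso : Iso G H) →
  ∀ {a b} → Adj G a b → Adj H (Inverse.to (proj₁ iso) a) (Inverse.to (proj₁ iso) b)
Iso-adj G H (_ , φ-arc) {a} {b} (inj₁ ab) = inj₁ (trans (φ-arc a b) ab)
Iso-adj G H (_ , φ-arc) {a} {b} (inj₂ ba) = inj₂ (trans (φ-arc b a) ba)

module IsoTransport (G H : Digraph) (iso : Iso G H) where
  open Inverse (proj₁ iso) public using (to; from)
  open Inverse (proj₁ iso) using (strictlyInverseˡ; strictlyInverseʳ)

  pull-Hom : ∀ {X} → Hom H X → Hom G X
  pull-Hom {X} ζ = record
    { map = pull to (map ζ)
    ; hom = pull-isHom G H to (λ v w → trans (proj₂ iso v w)) X (map ζ) (hom ζ)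
    }

  pull∘pull⁻¹ : (g : Vec A (order G)) → pull to (pull from g) ≡ g
  pull∘pull⁻¹ = pull-inverse to from strictlyInverseʳ

  pull⁻¹∘pull : (ζ : Vec A (order H)) → pull from (pull to ζ) ≡ ζ
  pull⁻¹∘pull = pull-inverse from to strictlyInverseˡ

  pull-injective : {f g : Vec A (order H)} → pull to f ≡ pull to g → f ≡ g
  pull-injective {f = f} {g} e = trans (sym (pull⁻¹∘pull f)) (trans (cong (pull from) e) (pull⁻¹∘pull g))

  Γ-pull : (ζ : Vec (Fin m) (order H)) → ∀ v w → Γ G (pull to ζ) v w ⇔ Γ H ζ (to v) (to w)
  Γ-pull ζ v w = mk⇔
    (Conn-map G H to (Iso-adj G H iso) (sym ∘ lookup-pull to ζ))
    (subst₂ (Conn G (pull to ζ)) (strictlyInverseʳ v) (strictlyInverseʳ w) ∘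
      Conn-map H G from (Iso-adj H G (Iso-sym G H iso)) pull-to∘from)
    where
    pull-to∘from : ∀ a → lookup (pull to ζ) (from a) ≡ lookup ζ a
    pull-to∘from a = trans (lookup-pull to ζ (from a)) (cong (lookup ζ) (strictlyInverseˡ a))

-- Γ-preserving injections

ΓInjection : (G R S : Digraph) → Set
ΓInjection G R S = Σ (Hom G R → Hom G S) λ ρ →
  (∀ ξ ξ' → map (ρ ξ) ≡ map (ρ ξ') → map ξ ≡ map ξ') ×
  (∀ ξ v w → Γ G (map (ρ ξ)) v w ⇔ Γ G (map ξ) v w)

ΓInjection-transport : ∀ {G H R S} → Iso G H → ΓInjection H R S → ΓInjection G R S
ΓInjection-transport {G} {H} {R} {S} iso (ρ , ρ-injective , ρ-Γ) = ρ' , ρ'-injective , ρ'-Γ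
  where
  open IsoTransport G H iso
  module Inv = IsoTransport H G (Iso-sym G H iso)
  ρ' : Hom G R → Hom G S
  ρ' ξ = pull-Hom (ρ (Inv.pull-Hom ξ))
  ρ'-injective : ∀ ξ ξ' → map (ρ' ξ) ≡ map (ρ' ξ') → map ξ ≡ map ξ'
  ρ'-injective ξ ξ' e = Inv.pull-injective (ρ-injective _ _ (pull-injective e))
  ρ'-Γ : ∀ ξ v w → Γ G (map (ρ' ξ)) v w ⇔ Γ G (map ξ) v w
  ρ'-Γ ξ v w = subst (λ g → Γ G (map (ρ' ξ)) v w ⇔ Γ G g v w) (pull∘pull⁻¹ (map ξ))
    (⇔-sym (Γ-pull _ v w) ⇔-∘ (ρ-Γ _ (to v) (to w) ⇔-∘ Γ-pull _ v w))

ΓInjection⇒≤# : ∀ {G R S} → ΓInjection G R S → (ξ : Hom G R) → Θ G R (map ξ) ≤# Θ G S (map ξ)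
ΓInjection⇒≤# {G} {R} {S} (ρ , ρ-injective , ρ-Γ) ξ = injection⇒≤# F F-Θ F-injective
  where
  asHom : ∀ ζ → Θ G R (map ξ) ζ → Hom G R
  asHom ζ (ζ-hom , _) = record { map = ζ ; hom = ζ-hom }
  F : ∀ ζ → Θ G R (map ξ) ζ → Map G S
  F ζ θ = map (ρ (asHom ζ θ))
  F-Θ : ∀ ζ θ → Θ G S (map ξ) (F ζ θ)
  F-Θ ζ θ@(_ , ζ~ξ) = hom (ρ (asHom ζ θ)) , SameΓ⇒Same𝓖 (SameΓ-trans (ρ-Γ _) (Same𝓖⇒SameΓ ζ~ξ))
  F-injective : ∀ ζ θ ζ' θ' → F ζ θ ≡ F ζ' θ' → ζ ≡ ζ'
  F-injective ζ θ ζ' θ' = ρ-injective (asHom ζ θ) (asHom ζ' θ')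

≤#⇒ΓInjection : ∀ {G R S} → ((ξ : Hom G R) → Θ G R (map ξ) ≤# Θ G S (map ξ)) → ΓInjection G R S
≤#⇒ΓInjection {G} {R} {S} R≤S = ρ , ρ-injective , ρ-Γ
  where
  enum : (X : Digraph) → Map G R → List (Map G X)
  enum X ξ = filter (Θ? G X ξ) (allMaps (order X) (order G))

  enum-unique : ∀ X ξ → Unique (enum X ξ)
  enum-unique X ξ = filter⁺ (Θ? G X ξ) (allMaps-unique _ _)

  enum-Card : ∀ X ξ → Card (Θ G X ξ) (length (enum X ξ))
  enum-Card X ξ = Card-filter (Θ? G X ξ) (allMaps-unique _ _) ∈-allMaps

  enum-cong : ∀ X {ξ ξ'} → SameΓ G ξ ξ' → enum X ξ ≡ enum X ξ'
  enum-cong X ξ~ξ' = filter-≐ (Θ? G X _) (Θ? G X _)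
    (Θ-resp G X ξ~ξ' , Θ-resp G X (SameΓ-sym ξ~ξ')) (allMaps (order X) (order G))

  ξ∈enum : (ξ : Hom G R) → map ξ ∈ enum R (map ξ)
  ξ∈enum ξ = ∈-filter⁺ (Θ? G R (map ξ)) (∈-allMaps (map ξ)) (hom ξ , SameΓ⇒Same𝓖 SameΓ-refl)

  enum-≤ : (ξ : Hom G R) → length (enum R (map ξ)) ≤ length (enum S (map ξ))
  enum-≤ ξ = R≤S ξ _ _ (enum-Card R (map ξ)) (enum-Card S (map ξ))

  choice : Hom G R → Map G S
  choice ξ = embed (enum R (map ξ)) (enum S (map ξ)) (enum-≤ ξ) (ξ∈enum ξ)

  choice-Θ : (ξ : Hom G R) → Θ G S (map ξ) (choice ξ)
  choice-Θ ξ = proj₂ (∈-filter⁻ (Θ? G S (map ξ)) {xs = allMaps _ _}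
    (embed-∈ (enum R (map ξ)) (enum S (map ξ)) (enum-≤ ξ) (ξ∈enum ξ)))

  ρ : Hom G R → Hom G S
  ρ ξ = record { map = choice ξ ; hom = proj₁ (choice-Θ ξ) }

  ρ-Γ : ∀ ξ v w → Γ G (map (ρ ξ)) v w ⇔ Γ G (map ξ) v w
  ρ-Γ ξ = Same𝓖⇒SameΓ (proj₂ (choice-Θ ξ))

  ρ-injective : ∀ ξ ξ' → map (ρ ξ) ≡ map (ρ ξ') → map ξ ≡ map ξ'
  -- ξ and ξ' have the same sets Γ, so their images were chosen by the same embedding.
  ρ-injective ξ ξ' e = embed-injective (enum-cong R ξ~ξ') (enum-cong S ξ~ξ') (enum-unique S (map ξ))
    (enum-≤ ξ) (enum-≤ ξ') (ξ∈enum ξ) (ξ∈enum ξ') e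
    where
    ξ~ξ' : SameΓ G (map ξ) (map ξ')
    ξ~ξ' = SameΓ-trans (SameΓ-sym (ρ-Γ ξ)) (subst (λ g → SameΓ G g (map ξ')) (sym e) (ρ-Γ ξ'))

lemma2 : (R S : Digraph) (𝔇 𝔇r : Digraph → Set) → IsRepSystem 𝔇 𝔇r →
    (R ⊑Γ S wrt 𝔇r) ⇔
    (∀ G → 𝔇 G → (ξ : Hom G R) → Θ G R (map ξ) ≤# Θ G S (map ξ))
lemma2 R S 𝔇 𝔇r (𝔇r⊆𝔇 , representative , _) = mk⇔
  (λ R⊑S G 𝔇G → let (H , 𝔇rH , G≅H) = representative G 𝔇G in
     ΓInjection⇒≤# (ΓInjection-transport G≅H (R⊑S H 𝔇rH)))
  (λ R≤S G 𝔇rG → ≤#⇒ΓInjection (R≤S G (𝔇r⊆𝔇 G 𝔇rG)))
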